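{- Let $G$ be a map on an orientable surface, $D_0$ an orientation of $G$ and $f_0$ a face of $G$, and let $D_{\max}$, $D_{\min}$ be the maximum and minimum of the distributive lattice $(O(G,D_0),\leq_{f_0})$. Then $D_{\max}$ contains no non-empty counterclockwise $0$-homologous oriented subgraph, and $D_{\min}$ contains no non-empty clockwise $0$-homologous oriented subgraph.
   Context: A map is a graph embedded on an orientable surface with all faces homeomorphic to open disks (contractible cycles of length 1 or 2 allowed). Fix a reference orientation; walks and oriented subgraphs have characteristic flows $\phi\in\mathbb{Z}^E$; $\mathbb{F}$ is the subgroup generated by characteristic flows of counterclockwise facial walks; $T$ is $0$-homologous if $\phi(T)\in\mathbb{F}$. Let $\mathcal{F}'$ be the counterclockwise facial walks of $G$ except the one of $f_0$. A $0$-homologous oriented subgraph $T$ is counterclockwise (resp. clockwise) if $\phi(T)=\sum_{F\in\mathcal{F}'}\lambda_F\phi(F)$ with all $\lambda_F\ge 0$ (resp. all $\lambda_F\le 0$). For orientations $D,D'$, $D\setminus D'$ is the oriented subgraph of $D$ of edges oriented differently in $D'$. $O(G,D_0)$ is the set of orientations $D$ with $D\setminus D_0$ $0$-homologous, ordered by $D\leq_{f_0}D'$ iff $D\setminus D'$ is counterclockwise; this is a finite distributive lattice. An oriented subgraph of $D$ is a set of edges each oriented as in $D$. -}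

module Defs where

open import Data.Nat using (ℕ; zero; suc) renaming (_*_ to _*ℕ_)
open import Data.Fin using (Fin)
open import Data.Fin.Properties using () renaming (_≟_ to _≟F_)
open import Data.Bool using (Bool; true; false; if_then_else_; not; _xor_)
open import Data.Bool.Properties using () renaming (_≟_ to _≟B_)
open import Data.Product using (Σ; ∃; ∃-syntax; _×_; _,_)
open import Data.Product.Properties using (≡-dec)
open import Data.Integer using (ℤ; _+_; _-_; _*_; _≤_; 0ℤ; 1ℤ; -1ℤ)
open import Data.List using (List; upTo; allFin; map; foldr)
open import Data.Bool.ListAction using (any)
open import Relation.Nullary.Decidable using (⌊_⌋)
open import Relation.Binary.PropositionalEquality using (_≡_)
open import Relation.Binary.Definitions using (DecidableEquality)

-- Edges are Fin m; each edge e has two darts (half-edges):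
--   (e , false) : e traversed in the reference direction,
--   (e , true)  : e traversed against the reference direction.
-- α swaps the two darts of an edge; σ is the rotation (cyclic order of
-- darts around their tail vertex).  Loops / multiple edges are allowed.

Dart : ℕ → Set
Dart m = Fin m × Bool

_≟D_ : ∀ {m} → DecidableEquality (Dart m)
_≟D_ = ≡-dec _≟F_ _≟B_

α : ∀ {m} → Dart m → Dart m
α (e , b) = e , not b

data Reach {m : ℕ} (σ : Dart m → Dart m) : Dart m → Dart m → Set where
  here : ∀ {d} → Reach σ d d
  viaσ : ∀ {d d'} → Reach σ (σ d) d' → Reach σ d d'
  viaα : ∀ {d d'} → Reach σ (α d) d' → Reach σ d d'

-- A map: a connected graph with a rotation system (= 2-cell embedding
-- in an orientable surface, all faces open disks).
record Map : Set where
  field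
    m         : ℕ
    σ         : Dart m → Dart m
    σ⁻¹       : Dart m → Dart m
    σ-inv₁    : ∀ d → σ⁻¹ (σ d) ≡ d
    σ-inv₂    : ∀ d → σ (σ⁻¹ d) ≡ d
    connected : ∀ d d' → Reach σ d d'

open Map public

iter : ∀ {A : Set} → (A → A) → ℕ → A → A
iter f zero    x = x
iter f (suc k) x = f (iter f k x)

module _ (G : Map) where

  -- Faces are the orbits of φ; the facial walk of the face of d traverses
  -- d, φ d, φ² d, ... (this is the "counterclockwise" facial walk).
  φ : Dart (m G) → Dart (m G)
  φ d = σ G (α d)

  -- d' lies on the face (φ-orbit) of d  (orbits have length ≤ 2m)
  sameFace : Dart (m G) → Dart (m G) → Bool
  sameFace d d' = any (λ k → ⌊ iter φ k d ≟D d' ⌋) (upTo (2 *ℕ m G))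

  ind : Bool → ℤ
  ind b = if b then 1ℤ else 0ℤ

  faceFlow : Dart (m G) → Fin (m G) → ℤ
  faceFlow d e = ind (sameFace d (e , false)) - ind (sameFace d (e , true))

  Σd : (Dart (m G) → ℤ) → ℤ
  Σd g = foldr _+_ 0ℤ (map (λ e → g (e , false) + g (e , true)) (allFin (m G)))

  Flow : Set
  Flow = Fin (m G) → ℤ

  Combo : Flow → (Dart (m G) → ℤ) → Set
  Combo ψ c = ∀ e → ψ e ≡ Σd (λ d → c d * faceFlow d e)

  ZeroHomologous : Flow → Set
  ZeroHomologous ψ = ∃[ c ] Combo ψ c

  -- counterclockwise w.r.t. f₀ (given by a dart d₀ on it): nonnegative
  -- combination of the facial flows of faces other than f₀
  Counterclockwise : Dart (m G) → Flow → Set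
  Counterclockwise d₀ ψ =
    ∃[ c ] ((∀ d → 0ℤ ≤ c d) × (∀ d → sameFace d₀ d ≡ true → c d ≡ 0ℤ) × Combo ψ c)

  Clockwise : Dart (m G) → Flow → Set
  Clockwise d₀ ψ =
    ∃[ c ] ((∀ d → c d ≤ 0ℤ) × (∀ d → sameFace d₀ d ≡ true → c d ≡ 0ℤ) × Combo ψ c)

  -- orientation: D e = false iff e is oriented as in the reference orientation
  Orientation : Set
  Orientation = Fin (m G) → Bool

  -- an oriented subgraph of D: a set of edges (S e = true), each oriented as in D
  EdgeSet : Set
  EdgeSet = Fin (m G) → Bool

  NonEmpty : EdgeSet → Set
  NonEmpty S = ∃[ e ] (S e ≡ true)

  sign : Bool → ℤ
  sign b = if b then -1ℤ else 1ℤ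

  flowSub : Orientation → EdgeSet → Flow
  flowSub D S e = if S e then sign (D e) else 0ℤ

  diff : Orientation → Orientation → EdgeSet
  diff D D' e = D e xor D' e

  flowDiff : Orientation → Orientation → Flow
  flowDiff D D' = flowSub D (diff D D')

  InO : Orientation → Orientation → Set
  InO D₀ D = ZeroHomologous (flowDiff D D₀)

  Leq : Dart (m G) → Orientation → Orientation → Set
  Leq d₀ D D' = Counterclockwise d₀ (flowDiff D D')

  IsMaximum : Dart (m G) → Orientation → Orientation → Set
  IsMaximum d₀ D₀ Dmax = InO D₀ Dmax × (∀ D → InO D₀ D → Leq d₀ D Dmax)

  IsMinimum : Dart (m G) → Orientation → Orientation → Set
  IsMinimum d₀ D₀ Dmin = InO D₀ Dmin × (∀ D → InO D₀ D → Leq d₀ Dmin D)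

module Submission where

-- Key fact: the cone of counterclockwise flows is pointed (ψ and -ψ both
-- counterclockwise imply ψ = 0).  Adding the two nonnegative combinations
-- gives coefficients h ≥ 0, zero on f₀, whose combination of facial flows
-- is 0.  The face weight W_h(x), the sum of h over the darts of the face of
-- x, satisfies ψ(e) = W(e⁺) - W(e⁻) for any combination; so W_h agrees on the
-- two darts of each edge, is constant on faces, hence constant on the
-- connected map, and vanishes on f₀.  As 0 ≤ c ≤ h, also W_c ≡ 0, so ψ = 0.
--
-- For the theorem,
-- reversing S in D_max (resp. D_min) stays in O(G, D₀), so by extremality
-- the flow of S is counterclockwise in both directions, hence 0.

open import Defs
open import Data.Product using (_×_; ∃-syntax; _,_)
open import Relation.Nullary using (¬_)

open import Data.Nat using (ℕ; zero; suc; _∸_; NonZero; >-nonZero)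
  renaming (_+_ to _+ℕ_; _*_ to _*ℕ_; _<_ to _<ℕ_; _≤_ to _≤ℕ_)
import Data.Nat.Properties as ℕP
open import Data.Nat.DivMod using (_%_; _/_; m≡m%n+[m/n]*n; m%n<n)
open import Data.Fin using (Fin; toℕ; join; splitAt)
import Data.Fin.Properties as FP
open import Data.Bool using (Bool; true; false; _xor_)
open import Data.Bool.Properties using (T-≡; ⇔→≡)
open import Data.Sum using (_⊎_; inj₁; inj₂)
open import Data.Integer using (ℤ; _+_; _-_; _*_; -_; _≤_; 0ℤ; 1ℤ)
import Data.Integer.Properties as ℤP
open import Data.Integer.Tactic.RingSolver using (solve-∀)
open import Data.List using (List; []; _∷_; upTo; allFin; map; foldr)
open import Data.List.Membership.Propositional using (lose; find)
open import Data.List.Membership.Propositional.Properties using (∈-upTo⁺)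
open import Data.List.Relation.Unary.Any.Properties using (any⁺; any⁻)
open import Relation.Nullary.Decidable using (toWitness; fromWitness)
open import Function.Bundles using (Equivalence; mk⇔)
open import Relation.Binary.PropositionalEquality

iter-+ : ∀ {A : Set} (f : A → A) a b x → iter f (a +ℕ b) x ≡ iter f a (iter f b x)
iter-+ f zero    b x = refl
iter-+ f (suc a) b x = cong f (iter-+ f a b x)

iter-injective : ∀ {A : Set} (f : A → A) → (∀ {x y} → f x ≡ f y → x ≡ y) →
                 ∀ k {x y} → iter f k x ≡ iter f k y → x ≡ y
iter-injective f inj zero    eq = eq
iter-injective f inj (suc k) eq = iter-injective f inj k (inj eq)

iter-periodic : ∀ {A : Set} (f : A → A) {x} p → iter f p x ≡ x → ∀ q → iter f (q *ℕ p) x ≡ x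
iter-periodic f {x} p fp zero    = refl
iter-periodic f {x} p fp (suc q) = begin
  iter f (p +ℕ q *ℕ p) x       ≡⟨ iter-+ f p (q *ℕ p) x ⟩
  iter f p (iter f (q *ℕ p) x) ≡⟨ cong (iter f p) (iter-periodic f p fp q) ⟩
  iter f p x                   ≡⟨ fp ⟩
  x                            ∎
  where open ≡-Reasoning

iter-mod : ∀ {A : Set} (f : A → A) {x} p .{{_ : NonZero p}} → iter f p x ≡ x →
           ∀ k → iter f k x ≡ iter f (k % p) x
iter-mod f {x} p fp k = begin
  iter f k x                                 ≡⟨ cong (λ n → iter f n x) (m≡m%n+[m/n]*n k p) ⟩
  iter f (k % p +ℕ (k / p) *ℕ p) x           ≡⟨ iter-+ f (k % p) ((k / p) *ℕ p) x ⟩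
  iter f (k % p) (iter f ((k / p) *ℕ p) x)   ≡⟨ cong (iter f (k % p)) (iter-periodic f p fp (k / p)) ⟩
  iter f (k % p) x                           ∎
  where open ≡-Reasoning

module _ (G : Map) where

  private
    N : ℕ
    N = m G

  -- Faces as orbits.  The face permutation φ is injective, and the darts can
  -- be encoded injectively into Fin (N + N), so each dart returns to itself
  -- after at most 2N steps.

  φ-injective : ∀ {x y} → φ G x ≡ φ G y → x ≡ y
  φ-injective {x} {y} eq = α-injective (begin
    α x                   ≡⟨ σ-inv₁ G (α x) ⟨
    σ⁻¹ G (σ G (α x))     ≡⟨ cong (σ⁻¹ G) eq ⟩
    σ⁻¹ G (σ G (α y))     ≡⟨ σ-inv₁ G (α y) ⟩
    α y                   ∎)
    where
    open ≡-Reasoning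
    α-injective : ∀ {x y : Dart N} → α x ≡ α y → x ≡ y
    α-injective {e , false} {e' , false} refl = refl
    α-injective {e , true}  {e' , true}  refl = refl

  dartSide : Dart N → Fin N ⊎ Fin N
  dartSide (e , false) = inj₁ e
  dartSide (e , true)  = inj₂ e

  dartSide-injective : ∀ {x y} → dartSide x ≡ dartSide y → x ≡ y
  dartSide-injective {e , false} {e' , false} refl = refl
  dartSide-injective {e , true}  {e' , true}  refl = refl
  dartSide-injective {e , false} {e' , true}  ()
  dartSide-injective {e , true}  {e' , false} ()

  dartCode : Dart N → Fin (N +ℕ N)
  dartCode d = join N N (dartSide d)

  dartCode-injective : ∀ {x y} → dartCode x ≡ dartCode y → x ≡ y
  dartCode-injective {x} {y} eq = dartSide-injective (begin
    dartSide x                          ≡⟨ FP.splitAt-join N N (dartSide x) ⟨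
    splitAt N (dartCode x)              ≡⟨ cong (splitAt N) eq ⟩
    splitAt N (dartCode y)              ≡⟨ FP.splitAt-join N N (dartSide y) ⟩
    dartSide y                          ∎)
    where open ≡-Reasoning

  period : ∀ d → ∃[ p ] (0 <ℕ p × p ≤ℕ N +ℕ N × iter (φ G) p d ≡ d)
  period d with FP.pigeonhole (ℕP.n<1+n (N +ℕ N)) (λ i → dartCode (iter (φ G) (toℕ i) d))
  ... | i , j , i<j , eq =
    toℕ j ∸ toℕ i , ℕP.m<n⇒0<n∸m i<j ,
    ℕP.≤-trans (ℕP.m∸n≤m (toℕ j) (toℕ i)) (FP.toℕ≤pred[n] j) ,
    iter-injective (φ G) φ-injective (toℕ i) (begin
      iter (φ G) (toℕ i) (iter (φ G) (toℕ j ∸ toℕ i) d)   ≡⟨ iter-+ (φ G) (toℕ i) (toℕ j ∸ toℕ i) d ⟨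
      iter (φ G) (toℕ i +ℕ (toℕ j ∸ toℕ i)) d            ≡⟨ cong (λ n → iter (φ G) n d) (ℕP.m+[n∸m]≡n (ℕP.<⇒≤ i<j)) ⟩
      iter (φ G) (toℕ j) d                               ≡⟨ dartCode-injective eq ⟨
      iter (φ G) (toℕ i) d                               ∎)
    where open ≡-Reasoning

  OnFace : Dart N → Dart N → Set
  OnFace d x = ∃[ k ] (iter (φ G) k d ≡ x)

  onFace-trans : ∀ {d x y} → OnFace d x → OnFace x y → OnFace d y
  onFace-trans {d} (k , refl) (l , refl) = l +ℕ k , iter-+ (φ G) l k d

  onFace-step : ∀ x → OnFace x (φ G x)
  onFace-step x = 1 , refl

  -- φ-orbits are cycles, so the face relation is symmetric
  onFace-sym : ∀ {d x} → OnFace d x → OnFace x d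
  onFace-sym {d} (k , refl) with period d
  ... | p , p>0 , _ , closed = p ∸ r , (begin
    iter (φ G) (p ∸ r) (iter (φ G) k d)   ≡⟨ cong (iter (φ G) (p ∸ r)) (iter-mod (φ G) p closed k) ⟩
    iter (φ G) (p ∸ r) (iter (φ G) r d)   ≡⟨ iter-+ (φ G) (p ∸ r) r d ⟨
    iter (φ G) (p ∸ r +ℕ r) d             ≡⟨ cong (λ n → iter (φ G) n d) (ℕP.m∸n+n≡m (ℕP.<⇒≤ (m%n<n k p))) ⟩
    iter (φ G) p d                        ≡⟨ closed ⟩
    d                                     ∎)
    where
    open ≡-Reasoning
    instance _ : NonZero p
             _ = >-nonZero p>0
    r : ℕ
    r = k % p

  onFace⇒sameFace : ∀ {d x} → OnFace d x → sameFace G d x ≡ true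
  onFace⇒sameFace {d} (k , refl) with period d
  ... | p , p>0 , p≤2N , closed =
    Equivalence.to T-≡ (any⁺ _ (lose (∈-upTo⁺ r<2N) (fromWitness (sym (iter-mod (φ G) p closed k)))))
    where
    instance _ : NonZero p
             _ = >-nonZero p>0
    r<2N : k % p <ℕ 2 *ℕ N
    r<2N = subst (k % p <ℕ_) (cong (N +ℕ_) (sym (ℕP.+-identityʳ N))) (ℕP.<-≤-trans (m%n<n k p) p≤2N)

  sameFace⇒onFace : ∀ {d x} → sameFace G d x ≡ true → OnFace d x
  sameFace⇒onFace h with find (any⁻ _ (upTo (2 *ℕ N)) (Equivalence.from T-≡ h))
  ... | k , _ , found = k , toWitness found

  sameFace-sym : ∀ {d x} → sameFace G d x ≡ true → sameFace G x d ≡ true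
  sameFace-sym h = onFace⇒sameFace (onFace-sym (sameFace⇒onFace h))

  sameFace-φ : ∀ d x → sameFace G d (φ G x) ≡ sameFace G d x
  sameFace-φ d x = ⇔→≡ (mk⇔
    (λ h → onFace⇒sameFace (onFace-trans (sameFace⇒onFace h) (onFace-sym (onFace-step x))))
    (λ h → onFace⇒sameFace (onFace-trans (sameFace⇒onFace h) (onFace-step x))))

  -- Sums over darts.  Σd sums over the darts of all edges; ΣL is the same
  -- sum over the darts of an arbitrary list of edges, so induction applies.

  ΣL : List (Fin N) → (Dart N → ℤ) → ℤ
  ΣL L g = foldr _+_ 0ℤ (map (λ e → g (e , false) + g (e , true)) L)

  ΣL-cong : ∀ L {f g} → (∀ d → f d ≡ g d) → ΣL L f ≡ ΣL L g
  ΣL-cong []      h = refl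
  ΣL-cong (e ∷ L) h = cong₂ _+_ (cong₂ _+_ (h (e , false)) (h (e , true))) (ΣL-cong L h)

  ΣL-zero : ∀ L {f} → (∀ d → f d ≡ 0ℤ) → ΣL L f ≡ 0ℤ
  ΣL-zero []      h = refl
  ΣL-zero (e ∷ L) h rewrite h (e , false) | h (e , true) | ΣL-zero L h = refl

  ΣL-+ : ∀ L f g → ΣL L (λ d → f d + g d) ≡ ΣL L f + ΣL L g
  ΣL-+ []      f g = refl
  ΣL-+ (e ∷ L) f g rewrite ΣL-+ L f g =
    interchange (f (e , false)) (f (e , true)) (g (e , false)) (g (e , true)) (ΣL L f) (ΣL L g)
    where
    interchange : ∀ a b c d u v → (a + c + (b + d)) + (u + v) ≡ (a + b + u) + (c + d + v)
    interchange = solve-∀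

  ΣL-neg : ∀ L f → ΣL L (λ d → - f d) ≡ - ΣL L f
  ΣL-neg []      f = refl
  ΣL-neg (e ∷ L) f rewrite ΣL-neg L f = neg-sum (f (e , false)) (f (e , true)) (ΣL L f)
    where
    neg-sum : ∀ a b u → (- a + - b) + - u ≡ - (a + b + u)
    neg-sum = solve-∀

  ΣL-mono : ∀ L {f g} → (∀ d → f d ≤ g d) → ΣL L f ≤ ΣL L g
  ΣL-mono []      h = ℤP.≤-refl
  ΣL-mono (e ∷ L) h = ℤP.+-mono-≤ (ℤP.+-mono-≤ (h (e , false)) (h (e , true))) (ΣL-mono L h)

  faceWeight : (Dart N → ℤ) → Dart N → ℤ
  faceWeight c x = Σd G (λ d → c d * ind G (sameFace G d x))

  combo-weight : ∀ {ψ c} → Combo G ψ c → ∀ e → ψ e ≡ faceWeight c (e , false) - faceWeight c (e , true)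
  combo-weight {ψ} {c} combo e = begin
    ψ e
      ≡⟨ combo e ⟩
    Σd G (λ d → c d * (ind G (on d false) - ind G (on d true)))
      ≡⟨ ΣL-cong (allFin N) (λ d → ℤP.*-distribˡ-+ (c d) (ind G (on d false)) (- ind G (on d true))) ⟩
    Σd G (λ d → c d * ind G (on d false) + c d * - ind G (on d true))
      ≡⟨ ΣL-+ (allFin N) (λ d → c d * ind G (on d false)) (λ d → c d * - ind G (on d true)) ⟩
    faceWeight c (e , false) + Σd G (λ d → c d * - ind G (on d true))
      ≡⟨ cong (faceWeight c (e , false) +_) (ΣL-cong (allFin N) (λ d → sym (ℤP.neg-distribʳ-* (c d) (ind G (on d true))))) ⟩
    faceWeight c (e , false) + Σd G (λ d → - (c d * ind G (on d true)))
      ≡⟨ cong (faceWeight c (e , false) +_) (ΣL-neg (allFin N) (λ d → c d * ind G (on d true))) ⟩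
    faceWeight c (e , false) - faceWeight c (e , true)
      ∎
    where
    open ≡-Reasoning
    on : Dart N → Bool → Bool
    on d b = sameFace G d (e , b)

  faceWeight-mono : ∀ {c c'} → (∀ d → c d ≤ c' d) → ∀ x → faceWeight c x ≤ faceWeight c' x
  faceWeight-mono c≤c' x = ΣL-mono (allFin N) (λ d → scale (sameFace G d x) (c≤c' d))
    where
    scale : ∀ b {a a'} → a ≤ a' → a * ind G b ≤ a' * ind G b
    scale true  = ℤP.*-monoʳ-≤-nonNeg 1ℤ
    scale false = ℤP.*-monoʳ-≤-nonNeg 0ℤ

  combo-cong : ∀ {ψ ψ' c} → (∀ e → ψ e ≡ ψ' e) → Combo G ψ c → Combo G ψ' c
  combo-cong ψ≡ψ' combo e = trans (sym (ψ≡ψ' e)) (combo e)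

  combo-+ : ∀ {ψ ψ' c c'} → Combo G ψ c → Combo G ψ' c' →
            Combo G (λ e → ψ e + ψ' e) (λ d → c d + c' d)
  combo-+ {ψ} {ψ'} {c} {c'} combo combo' e = begin
    ψ e + ψ' e
      ≡⟨ cong₂ _+_ (combo e) (combo' e) ⟩
    Σd G (λ d → c d * faceFlow G d e) + Σd G (λ d → c' d * faceFlow G d e)
      ≡⟨ ΣL-+ (allFin N) (λ d → c d * faceFlow G d e) (λ d → c' d * faceFlow G d e) ⟨
    Σd G (λ d → c d * faceFlow G d e + c' d * faceFlow G d e)
      ≡⟨ ΣL-cong (allFin N) (λ d → ℤP.*-distribʳ-+ (faceFlow G d e) (c d) (c' d)) ⟨
    Σd G (λ d → (c d + c' d) * faceFlow G d e)
      ∎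
    where open ≡-Reasoning

  combo-neg : ∀ {ψ c} → Combo G ψ c → Combo G (λ e → - ψ e) (λ d → - c d)
  combo-neg {ψ} {c} combo e = begin
    - ψ e                                       ≡⟨ cong -_ (combo e) ⟩
    - Σd G (λ d → c d * faceFlow G d e)         ≡⟨ ΣL-neg (allFin N) (λ d → c d * faceFlow G d e) ⟨
    Σd G (λ d → - (c d * faceFlow G d e))       ≡⟨ ΣL-cong (allFin N) (λ d → ℤP.neg-distribˡ-* (c d) (faceFlow G d e)) ⟩
    Σd G (λ d → - c d * faceFlow G d e)         ∎
    where open ≡-Reasoning

  -- If coefficients h vanishing on the face f₀ of d₀ combine to the zero flow,
  -- then every face weight of h is 0: the weight is invariant under α (the
  -- flow on each edge is 0), under φ (it depends only on the face), hence
  -- under σ = φ ∘ α, hence constant on the connected map; at d₀ it is 0.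
  faceWeight-vanishes : ∀ d₀ h → (∀ d → sameFace G d₀ d ≡ true → h d ≡ 0ℤ) →
                        Combo G (λ _ → 0ℤ) h → ∀ x → faceWeight h x ≡ 0ℤ
  faceWeight-vanishes d₀ h off-f₀ combo x = trans (along (connected G d₀ x)) at-d₀
    where
    W : Dart N → ℤ
    W = faceWeight h

    -- the flow of the combination is 0 on every edge
    edge-balanced : ∀ e → W (e , false) ≡ W (e , true)
    edge-balanced e = ℤP.i-j≡0⇒i≡j (W (e , false)) (W (e , true)) (sym (combo-weight {c = h} combo e))

    W-α : ∀ y → W (α y) ≡ W y
    W-α (e , false) = sym (edge-balanced e)
    W-α (e , true)  = edge-balanced e

    W-φ : ∀ y → W (φ G y) ≡ W y
    W-φ y = ΣL-cong (allFin N) (λ d → cong (λ b → h d * ind G b) (sameFace-φ d y))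

    W-σ : ∀ y → W (σ G y) ≡ W y
    W-σ y = begin
      W (σ G y)             ≡⟨ cong (λ z → W (σ G z)) (α-involutive y) ⟨
      W (φ G (α y))         ≡⟨ W-φ (α y) ⟩
      W (α y)               ≡⟨ W-α y ⟩
      W y                   ∎
      where
      open ≡-Reasoning
      α-involutive : ∀ (z : Dart N) → α (α z) ≡ z
      α-involutive (e , false) = refl
      α-involutive (e , true)  = refl

    along : ∀ {y z} → Reach (σ G) y z → W z ≡ W y
    along here               = refl
    along {y} (viaσ reach)   = trans (along reach) (W-σ y)
    along {y} (viaα reach)   = trans (along reach) (W-α y)

    at-d₀ : W d₀ ≡ 0ℤ
    at-d₀ = ΣL-zero (allFin N) term
      where
      term : ∀ d → h d * ind G (sameFace G d d₀) ≡ 0ℤ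
      term d with sameFace G d d₀ in onF₀
      ... | true  = trans (ℤP.*-identityʳ (h d)) (off-f₀ d (sameFace-sym onF₀))
      ... | false = ℤP.*-zeroʳ (h d)

  counterclockwise-pointed : ∀ d₀ {ψ} → Counterclockwise G d₀ ψ →
    Counterclockwise G d₀ (λ e → - ψ e) → ∀ e → ψ e ≡ 0ℤ
  counterclockwise-pointed d₀ {ψ} (c , c≥0 , c-off , combo) (c' , c'≥0 , c'-off , combo') e =
    begin
      ψ e                                                    ≡⟨ combo-weight {c = c} combo e ⟩
      faceWeight c (e , false) - faceWeight c (e , true)     ≡⟨ cong₂ _-_ (W-zero (e , false)) (W-zero (e , true)) ⟩
      0ℤ                                                     ∎
    where
    open ≡-Reasoning
    h : Dart N → ℤ
    h d = c d + c' d

    h-vanishes : ∀ x → faceWeight h x ≡ 0ℤ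
    h-vanishes = faceWeight-vanishes d₀ h
      (λ d on-f₀ → cong₂ _+_ (c-off d on-f₀) (c'-off d on-f₀))
      (combo-cong {c = h} (λ e → ℤP.+-inverseʳ (ψ e)) (combo-+ {c = c} {c'} combo combo'))

    c≤h : ∀ d → c d ≤ h d
    c≤h d = subst (_≤ h d) (ℤP.+-identityʳ (c d)) (ℤP.+-monoʳ-≤ (c d) (c'≥0 d))

    W-zero : ∀ x → faceWeight c x ≡ 0ℤ
    W-zero x = ℤP.≤-antisym
      (subst (faceWeight c x ≤_) (h-vanishes x) (faceWeight-mono c≤h x))
      (subst (_≤ faceWeight c x) (ΣL-zero (allFin N) (λ d → ℤP.*-zeroˡ (ind G (sameFace G d x)))) (faceWeight-mono c≥0 x))

  counterclockwise-cong : ∀ d₀ {ψ ψ'} → (∀ e → ψ e ≡ ψ' e) →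
    Counterclockwise G d₀ ψ → Counterclockwise G d₀ ψ'
  counterclockwise-cong d₀ ψ≡ψ' (c , c≥0 , c-off , combo) = c , c≥0 , c-off , combo-cong {c = c} ψ≡ψ' combo

  clockwise⇒neg-counterclockwise : ∀ d₀ {ψ} → Clockwise G d₀ ψ → Counterclockwise G d₀ (λ e → - ψ e)
  clockwise⇒neg-counterclockwise d₀ (c , c≤0 , c-off , combo) =
    (λ d → - c d) , (λ d → ℤP.neg-mono-≤ (c≤0 d)) , (λ d on-f₀ → cong -_ (c-off d on-f₀)) , combo-neg {c = c} combo

  reverse : Orientation G → EdgeSet G → Orientation G
  reverse D S e = D e xor S e

  reverse-diff : ∀ D S D₀ e → flowDiff G (reverse D S) D₀ e ≡ flowDiff G D D₀ e - flowSub G D S e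
  reverse-diff D S D₀ e with D e | S e | D₀ e
  ... | false | false | false = refl
  ... | false | false | true  = refl
  ... | false | true  | false = refl
  ... | false | true  | true  = refl
  ... | true  | false | false = refl
  ... | true  | false | true  = refl
  ... | true  | true  | false = refl
  ... | true  | true  | true  = refl

  reverse-diff-from : ∀ D S e → flowDiff G (reverse D S) D e ≡ - flowSub G D S e
  reverse-diff-from D S e with D e | S e
  ... | false | false = refl
  ... | false | true  = refl
  ... | true  | false = refl
  ... | true  | true  = refl

  reverse-diff-to : ∀ D S e → flowDiff G D (reverse D S) e ≡ flowSub G D S e
  reverse-diff-to D S e with D e | S e
  ... | false | false = refl
  ... | false | true  = refl
  ... | true  | false = refl
  ... | true  | true  = refl

  reverse-inO : ∀ D₀ D S → InO G D₀ D → ZeroHomologous G (flowSub G D S) → InO G D₀ (reverse D S)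
  reverse-inO D₀ D S (c , combo) (c' , combo') =
    (λ d → c d + - c' d) ,
    combo-cong {c = λ d → c d + - c' d} (λ e → sym (reverse-diff D S D₀ e))
      (combo-+ {c = c} {λ d → - c' d} combo (combo-neg {c = c'} combo'))

  nonEmpty-flow : ∀ D S → NonEmpty G S → ¬ (∀ e → flowSub G D S e ≡ 0ℤ)
  nonEmpty-flow D S (e , e∈S) zero-flow with D e | S e | zero-flow e
  ... | false | true | ()
  ... | true  | true | ()

proposition39 : (G : Map) (D₀ : Orientation G) (d₀ : Dart (m G))
    (Dmax Dmin : Orientation G) →
    IsMaximum G d₀ D₀ Dmax → IsMinimum G d₀ D₀ Dmin →
    ((S : EdgeSet G) → NonEmpty G S →
    ZeroHomologous G (flowSub G Dmax S) →
    ¬ Counterclockwise G d₀ (flowSub G Dmax S))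
    ×
    ((S : EdgeSet G) → NonEmpty G S →
    ZeroHomologous G (flowSub G Dmin S) →
    ¬ Clockwise G d₀ (flowSub G Dmin S))
proposition39 G D₀ d₀ Dmax Dmin (Dmax∈O , aboveAll) (Dmin∈O , belowAll) = noCcwInMax , noCwInMin
  where
  -- Reversing S in Dmax gives an element of O below Dmax, so the reversed
  -- flow of S is counterclockwise too; pointedness forces the flow of S to be 0.
  noCcwInMax : (S : EdgeSet G) → NonEmpty G S →
    ZeroHomologous G (flowSub G Dmax S) → ¬ Counterclockwise G d₀ (flowSub G Dmax S)
  noCcwInMax S nonEmpty zeroHom ccw = nonEmpty-flow G Dmax S nonEmpty
    (counterclockwise-pointed G d₀ ccw
      (counterclockwise-cong G d₀ (reverse-diff-from G Dmax S)
        (aboveAll (reverse G Dmax S) (reverse-inO G D₀ Dmax S Dmax∈O zeroHom))))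

  -- Reversing S in Dmin gives an element of O above Dmin, so the flow of S is
  -- counterclockwise, while its negation is counterclockwise as S is clockwise.
  noCwInMin : (S : EdgeSet G) → NonEmpty G S →
    ZeroHomologous G (flowSub G Dmin S) → ¬ Clockwise G d₀ (flowSub G Dmin S)
  noCwInMin S nonEmpty zeroHom cw = nonEmpty-flow G Dmin S nonEmpty
    (counterclockwise-pointed G d₀
      (counterclockwise-cong G d₀ (reverse-diff-to G Dmin S)
        (belowAll (reverse G Dmin S) (reverse-inO G D₀ Dmin S Dmin∈O zeroHom)))
      (clockwise⇒neg-counterclockwise G d₀ cw))
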